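{- Let $d\ge 2$, let $\Pi=\{\boldsymbol\pi_1,\dots,\boldsymbol\pi_k\}$ and $T=\{\boldsymbol\tau_1,\dots,\boldsymbol\tau_{k'}\}$ be finite sets of patterns (each of dimension at most $d$), and let $s$ be a $d\times d$ signed permutation matrix such that $\widetilde{s}(\Pi)=T$ and $\Pi=\widetilde{s^{ -1}}(T)$. Then $\Pi$ and $T$ are trivially $d$-Wilf-equivalent, i.e. there exists a $d\times d$ signed permutation matrix $s'$ such that for every $n$, the map $\boldsymbol\sigma\mapsto s'(\boldsymbol\sigma)$ is a bijection from $S_n^{d-1}(\Pi)$ onto $S_n^{d-1}(T)$.
   Context: A $d$-permutation of size $n$ is a tuple $\boldsymbol\sigma=(\sigma_1,\dots,\sigma_{d-1})$ of permutations of $[n]$; its diagram is $P_{\boldsymbol\sigma}=\{(i,\sigma_1(i),\dots,\sigma_{d-1}(i)) : i\in[n]\}$, a set of points of $[n]^d$ with exactly one point on each hyperplane $x_r=j$; conversely each such point set is the diagram of a unique $d$-permutation. The standardization of a finite point set in $\mathbb{R}^d$ having distinct values in each coordinate is the point set in $[m]^d$ with the same relative order in each coordinate. For an increasing sequence $\mathbf i=(i_1<\dots<i_{d'})$ of indices in $[d]$, the (direct) projection $\mathrm{proj}_{\mathbf i}(\boldsymbol\sigma)$ is the $d'$-permutation whose diagram is $\{(p_{i_1},\dots,p_{i_{d'}}) : p\in P_{\boldsymbol\sigma}\}$. A $d$-permutation $\boldsymbol\sigma$ contains a $d'$-permutation pattern $\boldsymbol\pi$ of size $k$ ($d'\le d$)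 if some direct projection of $\boldsymbol\sigma$ of dimension $d'$ has a $k$-point subset of its diagram whose standardization is the diagram of $\boldsymbol\pi$; otherwise it avoids $\boldsymbol\pi$. $S_n^{d-1}(\Pi)$ is the set of $d$-permutations of size $n$ avoiding every pattern in $\Pi$. For a $d\times d$ signed permutation matrix $s$ (entries in $\{ -1,0,1\}$, exactly one nonzero entry in each row and column) and a $d$-permutation $\boldsymbol\sigma$, $s(\boldsymbol\sigma)$ is the $d$-permutation whose diagram is the standardization of $\{s p : p\in P_{\boldsymbol\sigma}\}$ (points as column vectors). For an increasing sequence $\mathbf i=(i_1<\dots<i_{d'})$, $s_{\mathbf i}$ is the $d'\times d'$ signed permutation matrix obtained from $s$ by keeping the rows with indices in $\mathbf i$ and the columns containing a nonzero entry in one of these rows (in their original order). For a pattern $\boldsymbol\pi$ of dimension $d'$, $\widetilde{s}(\{\boldsymbol\pi\})=\{s_{\mathbf i}(\boldsymbol\pi) : \mathbf i \text{ increasing of length } d'\}$, and for a set, $\widetilde{s}(\{\boldsymbol\pi_1,\dots,\boldsymbol\pi_k\})=\bigcup_j\widetilde{s}(\{\boldsymbol\pi_j\})$. -}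

module Defs where

open import Data.Nat as ℕ using (ℕ; zero; suc; _<?_)
open import Data.Integer as ℤ using (ℤ; +_; -[1+_]) renaming (_+_ to _+ℤ_; _*_ to _*ℤ_; _<_ to _<ℤ_; _≟_ to _≟ℤ_; _<?_ to _<ℤ?_)
open import Data.Fin using (Fin; zero; suc; toℕ; fromℕ<) renaming (_<_ to _<F_; _≟_ to _≟F_)
open import Data.Fin.Properties using (any?; all?)
open import Data.List using (List; []; _∷_; filter; length; allFin)
open import Data.List.Membership.Propositional using (_∈_)
open import Data.Maybe using (Maybe; just; nothing; maybe)
open import Data.Product using (Σ; ∃; ∃-syntax; _×_; _,_)
open import Data.Sum using (_⊎_)
open import Relation.Nullary using (¬_; yes; no; ¬?)
open import Relation.Binary.PropositionalEquality using (_≡_; _≢_)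
open import Function.Definitions using (Bijective; Injective)

-- Conventions: dimension d is written  suc e  (so a d-permutation is a
-- tuple of e = d-1 permutations).  Everything is 0-based: [n] is Fin n,
-- points of a diagram have coordinates in {0,…,n-1} (embedded in ℤ).

Point : ℕ → Set
Point d = Fin d → ℤ

Family : ℕ → ℕ → Set
Family m d = Fin m → Point d

SameSet : ∀ {m m' d} → Family m d → Family m' d → Set
SameSet {d = d} F G =
  (∀ a → ∃[ b ] (∀ (c : Fin d) → F a c ≡ G b c)) ×
  (∀ b → ∃[ a ] (∀ (c : Fin d) → G b c ≡ F a c))

DPerm : ℕ → ℕ → Set
DPerm e n = Fin e → Fin n → Fin n

IsDPerm : ∀ {e n} → DPerm e n → Set
IsDPerm σ = ∀ r → Bijective _≡_ _≡_ (σ r)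

_≗D_ : ∀ {e n} → DPerm e n → DPerm e n → Set
σ ≗D τ = ∀ r j → σ r j ≡ τ r j

diag : ∀ {e n} → DPerm e n → Family n (suc e)
diag σ i zero    = + toℕ i
diag σ i (suc r) = + toℕ (σ r i)

count : ∀ {m} → (Fin m → ℤ) → ℤ → ℕ
count {m} v x = length (filter (λ b → v b <ℤ? x) (allFin m))

std : ∀ {m d} → Family m d → Family m d
std q a c = + count (λ b → q b c) (q a c)

-- On families which are diagrams of
-- d-permutations this is the inverse of diag; elsewhere it is junk.
toFinOr : ∀ {n} → Fin n → ℤ → Fin n
toFinOr {n} d (+ m) with m <? n
... | yes p = fromℕ< p
... | no _  = d
toFinOr d -[1+ _ ] = d

fromDiagram : ∀ {e n} → Family n (suc e) → DPerm e n
fromDiagram q r j with any? (λ i → q i zero ≟ℤ + toℕ j)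
... | yes (i , _) = toFinOr j (q i (suc r))
... | no _        = j

Matrix : ℕ → Set
Matrix d = Fin d → Fin d → ℤ

sumFin : ∀ {m} → (Fin m → ℤ) → ℤ
sumFin {zero}  f = + 0
sumFin {suc m} f = f zero +ℤ sumFin (λ i → f (suc i))

_⊙_ : ∀ {d} → Matrix d → Point d → Point d
(M ⊙ p) r = sumFin (λ c → M r c *ℤ p c)

_⊗_ : ∀ {d} → Matrix d → Matrix d → Matrix d
(M ⊗ N) r c = sumFin (λ k → M r k *ℤ N k c)

idM : ∀ {d} → Matrix d
idM r c with r ≟F c
... | yes _ = + 1
... | no _  = + 0

IsSignedPerm : ∀ {d} → Matrix d → Set
IsSignedPerm {d} M =
  (∀ r c → M r c ≡ + 0 ⊎ M r c ≡ + 1 ⊎ M r c ≡ -[1+ 0 ]) ×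
  (∀ r → ∃[ c ] (M r c ≢ + 0 × (∀ c' → M r c' ≢ + 0 → c' ≡ c))) ×
  (∀ c → ∃[ r ] (M r c ≢ + 0 × (∀ r' → M r' c ≢ + 0 → r' ≡ r)))

act : ∀ {e n} → Matrix (suc e) → DPerm e n → DPerm e n
act M σ = fromDiagram (std (λ i → M ⊙ diag σ i))

Increasing : ∀ {d' d} → (Fin d' → Fin d) → Set
Increasing i = ∀ a b → a <F b → i a <F i b

nth : ∀ {A : Set} → List A → ℕ → Maybe A
nth []       _       = nothing
nth (x ∷ xs) zero    = just x
nth (x ∷ xs) (suc k) = nth xs k

subMatrix : ∀ {d' d} → Matrix d → (Fin d' → Fin d) → Matrix d'
subMatrix {d' = d'} {d} M i a b =
  maybe (λ c → M (i a) c) (+ 0) (nth cols (toℕ b))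
  where
  cols : List (Fin d)
  cols = filter (λ c → any? (λ a′ → ¬? (M (i a′) c ≟ℤ + 0))) (allFin d)

record Pattern : Set where
  constructor pat
  field
    dim′ : ℕ
    size : ℕ
    perm : DPerm dim′ size
open Pattern public

data _≈P_ : Pattern → Pattern → Set where
  eqP : ∀ {e k} {f g : DPerm e k} → f ≗D g → pat e k f ≈P pat e k g

proj : ∀ {e e' n} → (Fin (suc e') → Fin (suc e)) → DPerm e n → DPerm e' n
proj i σ = fromDiagram (λ t c → diag σ t (i c))

Contains : ∀ {e n} → DPerm e n → Pattern → Set
Contains {e} {n} σ (pat e' k f) =
  ∃[ i ] (Increasing {suc e'} {suc e} i ×
    Σ (Fin k → Fin n) λ sel → (Injective _≡_ _≡_ sel ×
      SameSet (std (λ a → diag (proj i σ) (sel a))) (diag f)))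

Avoids : ∀ {e n} → DPerm e n → List Pattern → Set
Avoids σ Π = ∀ π → π ∈ Π → ¬ Contains σ π

InS : ∀ {e} n → List Pattern → DPerm e n → Set
InS n Π σ = IsDPerm σ × Avoids σ Π

BijectionOn : ∀ {e n} → (DPerm e n → Set) → (DPerm e n → Set) →
              (DPerm e n → DPerm e n) → Set
BijectionOn A B f =
  (∀ σ → A σ → B (f σ)) ×
  (∀ σ₁ σ₂ → A σ₁ → A σ₂ → f σ₁ ≗D f σ₂ → σ₁ ≗D σ₂) ×
  (∀ τ → B τ → ∃[ σ ] (A σ × f σ ≗D τ))

InTilde : ∀ {d} → Matrix d → List Pattern → Pattern → Set
InTilde {d} s Π τ =
  ∃[ π ] (π ∈ Π × ∃[ i ] (Increasing {suc (dim′ π)} {d} i ×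
    τ ≈P pat (dim′ π) (size π) (act (subMatrix s i) (perm π))))

InList : List Pattern → Pattern → Set
InList T τ = ∃[ τ' ] (τ' ∈ T × τ ≈P τ')

SameSetP : (Pattern → Set) → (Pattern → Set) → Set
SameSetP A B = ∀ τ → (A τ → B τ) × (B τ → A τ)

TriviallyWilfEquiv : ℕ → List Pattern → List Pattern → Set
TriviallyWilfEquiv e Π T =
  ∃[ s' ] (IsSignedPerm {suc e} s' ×
    (∀ n → BijectionOn (InS {e} n Π) (InS n T) (act s')))

-- A signed permutation matrix s acts on a point by permuting its coordinates
-- and negating some of them, so it commutes with standardization.  Hence if
-- ρ contains a pattern τ in the coordinates i, then s(ρ) contains s_J(τ) in
-- the coordinates J, the rows of s whose nonzero entries lie in the columns
-- i.  Applied to s⁻¹: if s(σ) contained some τ ∈ T, then σ = s⁻¹(s(σ)) would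
-- contain a pattern of s̃⁻¹(T) = Π.  So s maps S_n(Π) into S_n(T), s⁻¹ maps
-- S_n(T) into S_n(Π), and the two maps are mutually inverse.
module Submission where

open import Defs
open import Data.Fin as Fin using (Fin; zero; suc; toℕ; fromℕ<; punchOut)
import Data.Fin.Properties as Finₚ
open import Data.Integer as ℤ using (ℤ; +_; -_; +<+; _◃_)
import Data.Integer.Properties as ℤₚ
open import Data.List using (List; []; _∷_; filter; length; allFin; tabulate)
import Data.List.Properties as Listₚ
open import Data.List.Membership.Propositional using (_∈_; lose)
open import Data.List.Membership.Propositional.Properties
  using (∈-allFin; ∈-filter⁺; ∈-filter⁻; ∈-tabulate⁺; ∈-tabulate⁻)
open import Data.List.Relation.Binary.Sublist.Propositional using (⊆-refl)
open import Data.List.Relation.Binary.Sublist.Propositional.Properties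
  using (length-mono-≤) renaming (filter⁺ to sublist-filter⁺)
open import Data.List.Relation.Unary.All as All using ()
open import Data.List.Relation.Unary.AllPairs using (AllPairs; []; _∷_)
import Data.List.Relation.Unary.AllPairs.Properties as AllPairsₚ
open import Data.List.Relation.Unary.Any using (here; there)
open import Data.Maybe using (just; maybe)
open import Data.Nat as ℕ using (ℕ; zero; suc; _≤_; _<_; s≤s; z<s; s<s)
import Data.Nat.Properties as ℕₚ
open import Data.Product using (Σ; ∃; ∃-syntax; _×_; _,_; proj₁; proj₂)
open import Data.Sign as Sign using (Sign)
open import Data.Sum using (inj₁; inj₂)
open import Function using (_∘_; id; _⇔_; mk⇔; Equivalence)
open import Function.Definitions using (Injective; Surjective)
open import Function.Properties.Equivalence using (⇔-isEquivalence)
open import Level using (0ℓ)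
open import Relation.Binary using (Setoid; IsEquivalence; tri<; tri≈; tri>)
import Relation.Binary.Reasoning.Setoid as SetoidReasoning
open import Relation.Binary.PropositionalEquality hiding (J)
open import Relation.Nullary using (¬_; yes; no; ¬?; contradiction)
open import Relation.Unary using (Pred; Decidable; _⊆_)

private
  variable
    m m′ n k d d′ e e′ : ℕ

module ⇔ {ℓ} = IsEquivalence (⇔-isEquivalence {ℓ})

-- Counting and standardization

module _ {A : Set} {P Q : Pred A 0ℓ} (P? : Decidable P) (Q? : Decidable Q) (P⇒Q : P ⊆ Q) where

  length-filter-mono : ∀ xs → length (filter P? xs) ≤ length (filter Q? xs)
  length-filter-mono xs = length-mono-≤ (sublist-filter⁺ P? Q? {as = xs} (λ { refl → P⇒Q }) ⊆-refl)

  length-filter-strict : ∀ {xs y} → y ∈ xs → Q y → ¬ P y →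
                         length (filter P? xs) < length (filter Q? xs)
  length-filter-strict {x ∷ xs} (here refl) Qy ¬Py with P? x | Q? x
  ... | yes Py | _      = contradiction Py ¬Py
  ... | no _   | yes _  = s≤s (length-filter-mono xs)
  ... | no _   | no ¬Qy = contradiction Qy ¬Qy
  length-filter-strict {x ∷ xs} (there y∈xs) Qy ¬Py with P? x | Q? x
  ... | yes _  | yes _  = s≤s (length-filter-strict y∈xs Qy ¬Py)
  ... | yes Px | no ¬Qx = contradiction (P⇒Q Px) ¬Qx
  ... | no _   | yes _  = ℕₚ.m≤n⇒m≤1+n (length-filter-strict y∈xs Qy ¬Py)
  ... | no _   | no _   = length-filter-strict y∈xs Qy ¬Py

count-mono-≤ : (v : Fin m → ℤ) {x y : ℤ} → x ℤ.≤ y → count v x ≤ count v y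
count-mono-≤ v x≤y =
  length-filter-mono (λ b → v b ℤ.<? _) (λ b → v b ℤ.<? _) (λ vb<x → ℤₚ.<-≤-trans vb<x x≤y) (allFin _)

count-mono-< : (v : Fin m → ℤ) {a b : Fin m} → v a ℤ.< v b → count v (v a) < count v (v b)
count-mono-< v {a} va<vb =
  length-filter-strict (λ b → v b ℤ.<? _) (λ b → v b ℤ.<? _) (λ vc<va → ℤₚ.<-trans vc<va va<vb)
    (∈-allFin a) va<vb (ℤₚ.<-irrefl refl)

count-cancel-< : (v : Fin m → ℤ) {a b : Fin m} → count v (v a) < count v (v b) → v a ℤ.< v b
count-cancel-< v {a} {b} lt with v a ℤ.<? v b
... | yes va<vb = va<vb
... | no va≮vb  = contradiction (count-mono-≤ v (ℤₚ.≮⇒≥ va≮vb)) (ℕₚ.<⇒≱ lt)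

count<size : (v : Fin m → ℤ) (a : Fin m) → count v (v a) < m
count<size {m} v a = subst (count v (v a) <_) (Listₚ.length-tabulate id)
  (Listₚ.filter-notAll (λ b → v b ℤ.<? v a) (allFin m) (lose (∈-allFin a) (ℤₚ.<-irrefl refl)))

std-mono-< : (F : Family m d) {a b : Fin m} {c : Fin d} → F a c ℤ.< F b c → std F a c ℤ.< std F b c
std-mono-< F lt = +<+ (count-mono-< (λ b → F b _) lt)

std-cancel-< : (F : Family m d) {a b : Fin m} {c : Fin d} → std F a c ℤ.< std F b c → F a c ℤ.< F b c
std-cancel-< F (+<+ lt) = count-cancel-< (λ b → F b _) lt

SameOrder : Family m d → Family m d → Set
SameOrder F G = ∀ a b c → (F a c ℤ.< F b c) ⇔ (G a c ℤ.< G b c)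

sameOrder-isEquivalence : IsEquivalence (SameOrder {m} {d})
sameOrder-isEquivalence = record
  { refl  = λ a b c → ⇔.refl
  ; sym   = λ F∼G a b c → ⇔.sym (F∼G a b c)
  ; trans = λ F∼G G∼H a b c → ⇔.trans (F∼G a b c) (G∼H a b c)
  }

sameOrder-setoid : ℕ → ℕ → Setoid 0ℓ 0ℓ
sameOrder-setoid m d = record { isEquivalence = sameOrder-isEquivalence {m} {d} }

module SameOrder {m d} = IsEquivalence (sameOrder-isEquivalence {m} {d})

restrict : Family m d → (Fin m′ → Fin m) → (Fin d′ → Fin d) → Family m′ d′
restrict F g J a c = F (g a) (J c)

≗⇒sameOrder : {F G : Family m d} → (∀ a c → F a c ≡ G a c) → SameOrder F G
≗⇒sameOrder F≗G a b c =
  mk⇔ (subst₂ ℤ._<_ (F≗G a c) (F≗G b c)) (subst₂ ℤ._<_ (sym (F≗G a c)) (sym (F≗G b c)))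

sameOrder-restrict : {F G : Family m d} → SameOrder F G →
                     (g : Fin m′ → Fin m) (J : Fin d′ → Fin d) → SameOrder (restrict F g J) (restrict G g J)
sameOrder-restrict F∼G g J a b c = F∼G (g a) (g b) (J c)

std-sameOrder : (F : Family m d) → SameOrder (std F) F
std-sameOrder F a b c = mk⇔ (std-cancel-< F) (std-mono-< F)

sameOrder⇒std-≡ : {F G : Family m d} → SameOrder F G → ∀ a c → std F a c ≡ std G a c
sameOrder⇒std-≡ F∼G a c = cong (+_ ∘ length)
  (Listₚ.filter-≐ _ _ ((λ {b} → Equivalence.to (F∼G b a c)) , (λ {b} → Equivalence.from (F∼G b a c)))
                  (allFin _))

injective⇒surjective : {f : Fin m → Fin m} → Injective _≡_ _≡_ f → Surjective _≡_ _≡_ f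
injective⇒surjective {suc m} {f} f-inj y with Finₚ.any? (λ x → f x Fin.≟ y)
... | yes (x , fx≡y) = x , λ { refl → fx≡y }
... | no ∄x = contradiction (Finₚ.injective⇒≤ f̂-inj) (ℕₚ.<-irrefl refl)
  where
  y≢f : ∀ x → y ≢ f x
  y≢f x y≡fx = ∄x (x , sym y≡fx)
  f̂ : Fin (suc m) → Fin m
  f̂ x = punchOut (y≢f x)
  f̂-inj : Injective _≡_ _≡_ f̂
  f̂-inj eq = f-inj (Finₚ.punchOut-injective (y≢f _) (y≢f _) eq)

module _ {f : Fin m → Fin m} (f-inj : Injective _≡_ _≡_ f) where

  preimage : Fin m → Fin m
  preimage y = proj₁ (injective⇒surjective f-inj y)

  apply-preimage : ∀ y → f (preimage y) ≡ y
  apply-preimage y = proj₂ (injective⇒surjective f-inj y) refl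

  preimage-apply : ∀ x → preimage (f x) ≡ x
  preimage-apply x = f-inj (apply-preimage (f x))

  preimage-injective : Injective _≡_ _≡_ preimage
  preimage-injective {y} {y′} eq = trans (sym (apply-preimage y)) (trans (cong f eq) (apply-preimage y′))

increasing⇒injective : {f : Fin m → Fin n} → Increasing f → Injective _≡_ _≡_ f
increasing⇒injective f↑ {a} {b} fa≡fb with Finₚ.<-cmp a b
... | tri< a<b _ _ = contradiction fa≡fb (Finₚ.<⇒≢ (f↑ a b a<b))
... | tri≈ _ a≡b _ = a≡b
... | tri> _ _ b<a = contradiction (sym fa≡fb) (Finₚ.<⇒≢ (f↑ b a b<a))

increasing-gap : {f : Fin (suc m) → Fin n} → Increasing f → ∀ x → toℕ (f zero) ℕ.+ toℕ x ≤ toℕ (f x)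
increasing-gap f↑ zero = ℕₚ.≤-reflexive (ℕₚ.+-identityʳ _)
increasing-gap {suc m} {f = f} f↑ (suc x) = begin
  toℕ (f zero) ℕ.+ suc (toℕ x)  ≡⟨ ℕₚ.+-suc (toℕ (f zero)) (toℕ x) ⟩
  suc (toℕ (f zero)) ℕ.+ toℕ x  ≤⟨ ℕₚ.+-monoˡ-≤ (toℕ x) (f↑ zero (suc zero) z<s) ⟩
  toℕ (f (suc zero)) ℕ.+ toℕ x  ≤⟨ increasing-gap (λ a b a<b → f↑ (suc a) (suc b) (s<s a<b)) x ⟩
  toℕ (f (suc x))               ∎
  where open ℕₚ.≤-Reasoning

increasing⇒≤ : {f : Fin m → Fin n} → Increasing f → ∀ x → toℕ x ≤ toℕ (f x)
increasing⇒≤ {suc m} f↑ x = ℕₚ.≤-trans (ℕₚ.m≤n+m (toℕ x) _) (increasing-gap f↑ x)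

-- The inverse g is increasing as well, so f x ≤ g (f x) = x.
increasing⇒≗id : {f : Fin m → Fin m} → Increasing f → ∀ x → f x ≡ x
increasing⇒≗id {m} {f} f↑ x = Finₚ.toℕ-injective (ℕₚ.≤-antisym fx≤x (increasing⇒≤ f↑ x))
  where
  f-inj : Injective _≡_ _≡_ f
  f-inj = increasing⇒injective f↑
  g : Fin m → Fin m
  g = preimage f-inj
  g↑ : Increasing g
  g↑ a b a<b with Finₚ.<-cmp (g a) (g b)
  ... | tri< ga<gb _ _ = ga<gb
  ... | tri≈ _ ga≡gb _ = contradiction (preimage-injective f-inj ga≡gb) (Finₚ.<⇒≢ a<b)
  ... | tri> _ _ gb<ga = contradiction
    (subst₂ Fin._<_ (apply-preimage f-inj b) (apply-preimage f-inj a) (f↑ (g b) (g a) gb<ga))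
    (Finₚ.<-asym a<b)
  fx≤x : toℕ (f x) ≤ toℕ x
  fx≤x = subst (λ y → toℕ (f x) ≤ toℕ y) (preimage-apply f-inj x) (increasing⇒≤ g↑ (f x))

DistinctCoordinates : Family m d → Set
DistinctCoordinates F = ∀ c {a b} → F a c ≡ F b c → a ≡ b

IsPermFamily : Family m d → Set
IsPermFamily {m} F = ∀ c → ∃[ ρ ] (Injective _≡_ _≡_ ρ × ∀ a → F a c ≡ + toℕ {m} (ρ a))

isPermFamily⇒distinct : {F : Family m d} → IsPermFamily F → DistinctCoordinates F
isPermFamily⇒distinct F-perm c {a} {b} Fa≡Fb with F-perm c
... | ρ , ρ-inj , F≡ρ =
  ρ-inj (Finₚ.toℕ-injective (ℤₚ.+-injective (trans (sym (F≡ρ a)) (trans Fa≡Fb (F≡ρ b)))))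

restrict-distinct : {F : Family m d} → DistinctCoordinates F →
                    {g : Fin m′ → Fin m} → Injective _≡_ _≡_ g →
                    (J : Fin d′ → Fin d) → DistinctCoordinates (restrict F g J)
restrict-distinct F-distinct g-inj J c eq = g-inj (F-distinct (J c) eq)

restrict-isPermFamily : {F : Family m d} → IsPermFamily F → {g : Fin m → Fin m} → Injective _≡_ _≡_ g →
                        (J : Fin d′ → Fin d) → IsPermFamily (restrict F g J)
restrict-isPermFamily F-perm {g} g-inj J c with F-perm (J c)
... | ρ , ρ-inj , F≡ρ = ρ ∘ g , g-inj ∘ ρ-inj , F≡ρ ∘ g

std-distinct : {F : Family m d} → DistinctCoordinates F → DistinctCoordinates (std F)
std-distinct {F = F} F-distinct c {a} {b} eq with ℤₚ.<-cmp (F a c) (F b c)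
... | tri< lt _ _ = contradiction eq (ℤₚ.<⇒≢ (std-mono-< F lt))
... | tri≈ _ eq′ _ = F-distinct c eq′
... | tri> _ _ gt = contradiction (sym eq) (ℤₚ.<⇒≢ (std-mono-< F gt))

std-isPermFamily : {F : Family m d} → DistinctCoordinates F → IsPermFamily (std F)
std-isPermFamily {m} {F = F} F-distinct c = rank , rank-injective , std≡rank
  where
  rank : Fin m → Fin m
  rank a = fromℕ< (count<size (λ b → F b c) a)
  std≡rank : ∀ a → std F a c ≡ + toℕ (rank a)
  std≡rank a = cong +_ (sym (Finₚ.toℕ-fromℕ< _))
  rank-injective : Injective _≡_ _≡_ rank
  rank-injective {a} {b} eq =
    std-distinct F-distinct c (trans (std≡rank a) (trans (cong (+_ ∘ toℕ) eq) (sym (std≡rank b))))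

-- A permutation family is determined by its order type: comparing two of
-- them gives an increasing permutation of Fin m, which is the identity.
sameOrder⇒≗ : {F G : Family m d} → IsPermFamily F → IsPermFamily G → SameOrder F G →
              ∀ a c → F a c ≡ G a c
sameOrder⇒≗ {F = F} {G} F-perm G-perm F∼G a c with F-perm c | G-perm c
... | ρ , ρ-inj , F≡ρ | ρ′ , ρ′-inj , G≡ρ′ = begin
  F a c                              ≡⟨ F≡ρ a ⟩
  + toℕ (ρ a)                        ≡⟨ cong (+_ ∘ toℕ) (increasing⇒≗id h↑ (ρ a)) ⟨
  + toℕ (ρ′ (preimage ρ-inj (ρ a)))  ≡⟨ cong (+_ ∘ toℕ ∘ ρ′) (preimage-apply ρ-inj a) ⟩
  + toℕ (ρ′ a)                       ≡⟨ G≡ρ′ a ⟨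
  G a c                              ∎
  where
  open ≡-Reasoning
  F-preimage : ∀ x → F (preimage ρ-inj x) c ≡ + toℕ x
  F-preimage x = trans (F≡ρ _) (cong (+_ ∘ toℕ) (apply-preimage ρ-inj x))
  h↑ : Increasing (ρ′ ∘ preimage ρ-inj)
  h↑ x y x<y = ℤₚ.drop‿+<+ (subst₂ ℤ._<_ (G≡ρ′ _) (G≡ρ′ _) (Equivalence.to (F∼G _ _ c)
    (subst₂ ℤ._<_ (sym (F-preimage x)) (sym (F-preimage y)) (+<+ x<y))))

std-reindex : {G : Family m d} → DistinctCoordinates G → {h : Fin m → Fin m} → Injective _≡_ _≡_ h →
              ∀ a c → std (restrict G h id) a c ≡ std G (h a) c
std-reindex {G = G} G-distinct {h} h-inj =
  sameOrder⇒≗ (std-isPermFamily (restrict-distinct G-distinct h-inj id))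
              (restrict-isPermFamily (std-isPermFamily G-distinct) h-inj id)
              (begin
                std (restrict G h id)     ≈⟨ std-sameOrder _ ⟩
                restrict G h id           ≈⟨ sameOrder-restrict (std-sameOrder G) h id ⟨
                restrict (std G) h id     ∎)
  where open SetoidReasoning (sameOrder-setoid _ _)

-- Diagrams

diag-isPermFamily : {σ : DPerm e n} → IsDPerm σ → IsPermFamily (diag σ)
diag-isPermFamily σ-perm zero    = id , id , λ _ → refl
diag-isPermFamily σ-perm (suc r) = _ , proj₁ (σ-perm r) , λ _ → refl

diag-cong : {σ σ′ : DPerm e n} → σ ≗D σ′ → ∀ a c → diag σ a c ≡ diag σ′ a c
diag-cong σ≗σ′ a zero    = refl
diag-cong σ≗σ′ a (suc r) = cong (+_ ∘ toℕ) (σ≗σ′ r a)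

toFinOr-toℕ : (j x : Fin n) → toFinOr j (+ toℕ x) ≡ x
toFinOr-toℕ {n} j x with toℕ x ℕ.<? n
... | yes x<n = Finₚ.fromℕ<-toℕ x x<n
... | no x≮n  = contradiction (Finₚ.toℕ<n x) x≮n

module _ {q : Family n (suc e)} (q-perm : IsPermFamily q) where

  first : Fin n → Fin n
  first = proj₁ (q-perm zero)

  first-injective : Injective _≡_ _≡_ first
  first-injective = proj₁ (proj₂ (q-perm zero))

  first-coordinate : ∀ a → q a zero ≡ + toℕ (first a)
  first-coordinate = proj₂ (proj₂ (q-perm zero))

  pointAt : Fin n → Fin n
  pointAt = preimage first-injective

  fromDiagram-reads : ∀ {a j} → q a zero ≡ + toℕ j → ∀ r → + toℕ (fromDiagram q r j) ≡ q a (suc r)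
  fromDiagram-reads {a} {j} qa≡j r with Finₚ.any? (λ i → q i zero ℤ.≟ + toℕ j)
  ... | no ∄i = contradiction (a , qa≡j) ∄i
  ... | yes (a′ , qa′≡j) with isPermFamily⇒distinct q-perm zero (trans qa′≡j (sym qa≡j))
  ... | refl with q-perm (suc r)
  ... | ρ , _ , q≡ρ = begin
    + toℕ (toFinOr j (q a (suc r)))    ≡⟨ cong (+_ ∘ toℕ ∘ toFinOr j) (q≡ρ a) ⟩
    + toℕ (toFinOr j (+ toℕ (ρ a)))    ≡⟨ cong (+_ ∘ toℕ) (toFinOr-toℕ j (ρ a)) ⟩
    + toℕ (ρ a)                        ≡⟨ q≡ρ a ⟨
    q a (suc r)                        ∎
    where open ≡-Reasoning

  diag-fromDiagram : ∀ a c → diag (fromDiagram q) (first a) c ≡ q a c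
  diag-fromDiagram a zero    = sym (first-coordinate a)
  diag-fromDiagram a (suc r) = fromDiagram-reads (first-coordinate a) r

  diag-fromDiagram-pointAt : ∀ j c → diag (fromDiagram q) j c ≡ q (pointAt j) c
  diag-fromDiagram-pointAt j c =
    subst (λ j′ → diag (fromDiagram q) j′ c ≡ q (pointAt j) c)
          (apply-preimage first-injective j) (diag-fromDiagram (pointAt j) c)

  fromDiagram-isDPerm : IsDPerm (fromDiagram q)
  fromDiagram-isDPerm r = injective , injective⇒surjective injective
    where
    injective : Injective _≡_ _≡_ (fromDiagram q r)
    injective {j} {j′} eq = preimage-injective first-injective (isPermFamily⇒distinct q-perm (suc r) (begin
      q (pointAt j) (suc r)       ≡⟨ diag-fromDiagram-pointAt j (suc r) ⟨
      + toℕ (fromDiagram q r j)   ≡⟨ cong (+_ ∘ toℕ) eq ⟩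
      + toℕ (fromDiagram q r j′)  ≡⟨ diag-fromDiagram-pointAt j′ (suc r) ⟩
      q (pointAt j′) (suc r)      ∎))
      where open ≡-Reasoning

  fromDiagram-≗D : {σ : DPerm e n} {φ : Fin n → Fin n} → (∀ a c → q a c ≡ diag σ (φ a) c) →
                   fromDiagram q ≗D σ
  fromDiagram-≗D {σ} {φ} q≡σφ r j = Finₚ.toℕ-injective (ℤₚ.+-injective (begin
    + toℕ (fromDiagram q r j)    ≡⟨ diag-fromDiagram-pointAt j (suc r) ⟩
    q (pointAt j) (suc r)        ≡⟨ q≡σφ (pointAt j) (suc r) ⟩
    + toℕ (σ r (φ (pointAt j)))  ≡⟨ cong (+_ ∘ toℕ ∘ σ r) φ-pointAt ⟩
    + toℕ (σ r j)                ∎))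
    where
    open ≡-Reasoning
    φ-pointAt : φ (pointAt j) ≡ j
    φ-pointAt = Finₚ.toℕ-injective (ℤₚ.+-injective
      (trans (sym (q≡σφ (pointAt j) zero)) (sym (diag-fromDiagram-pointAt j zero))))

fromDiagram-cong : {q q′ : Family n (suc e)} → IsPermFamily q → IsPermFamily q′ →
                   (∀ a c → q a c ≡ q′ a c) → fromDiagram q ≗D fromDiagram q′
fromDiagram-cong q-perm q′-perm q≗q′ =
  fromDiagram-≗D q-perm (λ a c → trans (q≗q′ a c) (sym (diag-fromDiagram q′-perm a c)))

-- Signed permutation matrices

signed : Sign → ℤ → ℤ
signed Sign.+ x = x
signed Sign.- x = - x

signed-involutive : ∀ s x → signed s (signed s x) ≡ x
signed-involutive Sign.+ x = refl
signed-involutive Sign.- x = ℤₚ.neg-involutive x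

signed-injective : ∀ s {x y} → signed s x ≡ signed s y → x ≡ y
signed-injective Sign.+ eq = eq
signed-injective Sign.- eq = ℤₚ.neg-injective eq

◃1-* : ∀ s x → (s ◃ 1) ℤ.* x ≡ signed s x
◃1-* Sign.+ x = ℤₚ.*-identityˡ x
◃1-* Sign.- x = ℤₚ.-1*i≡-i x

signed-<-⇔ : ∀ s {x y x′ y′} → (x ℤ.< y) ⇔ (x′ ℤ.< y′) → (y ℤ.< x) ⇔ (y′ ℤ.< x′) →
             (signed s x ℤ.< signed s y) ⇔ (signed s x′ ℤ.< signed s y′)
signed-<-⇔ Sign.+ x<y⇔ _    = x<y⇔
signed-<-⇔ Sign.- _    y<x⇔ = mk⇔
  (λ lt → ℤₚ.neg-mono-< (Equivalence.to y<x⇔ (ℤₚ.neg-cancel-< lt)))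
  (λ lt → ℤₚ.neg-mono-< (Equivalence.from y<x⇔ (ℤₚ.neg-cancel-< lt)))

signed-0 : ∀ s → signed s (+ 0) ≡ + 0
signed-0 Sign.+ = refl
signed-0 Sign.- = refl

signed-1 : ∀ s → signed s (+ 1) ≡ s ◃ 1
signed-1 Sign.+ = refl
signed-1 Sign.- = refl

◃1≢0 : ∀ s → s ◃ 1 ≢ + 0
◃1≢0 Sign.+ ()
◃1≢0 Sign.- ()

record SignedPermForm (M : Matrix d) : Set where
  field
    col row  : Fin d → Fin d
    sign     : Fin d → Sign
    col∘row  : ∀ c → col (row c) ≡ c
    row∘col  : ∀ r → row (col r) ≡ r
    off-support : ∀ r c → col r ≢ c → M r c ≡ + 0
    on-support  : ∀ r → M r (col r) ≡ sign r ◃ 1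

isSignedPerm⇒form : {M : Matrix d} → IsSignedPerm M → SignedPermForm M
isSignedPerm⇒form {d} {M} (entries , rows , cols) = record
  { col = col ; row = row ; sign = λ r → proj₁ (unit r)
  ; col∘row = λ c → sym (proj₂ (proj₂ (rows (row c))) c (proj₁ (proj₂ (cols c))))
  ; row∘col = λ r → sym (proj₂ (proj₂ (cols (col r))) r (proj₁ (proj₂ (rows r))))
  ; off-support = off-support ; on-support = λ r → proj₂ (unit r) }
  where
  col row : Fin d → Fin d
  col r = proj₁ (rows r)
  row c = proj₁ (cols c)
  unit : ∀ r → ∃[ s ] (M r (col r) ≡ s ◃ 1)
  unit r with entries r (col r)
  ... | inj₁ ≡0        = contradiction ≡0 (proj₁ (proj₂ (rows r)))
  ... | inj₂ (inj₁ ≡1) = Sign.+ , ≡1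
  ... | inj₂ (inj₂ ≡-1) = Sign.- , ≡-1
  off-support : ∀ r c → col r ≢ c → M r c ≡ + 0
  off-support r c col≢c with M r c ℤ.≟ + 0
  ... | yes ≡0 = ≡0
  ... | no ≢0  = contradiction (sym (proj₂ (proj₂ (rows r)) c ≢0)) col≢c

sumFin-zero : (f : Fin m → ℤ) → (∀ k → f k ≡ + 0) → sumFin f ≡ + 0
sumFin-zero {zero}  f f≡0 = refl
sumFin-zero {suc m} f f≡0 = cong₂ ℤ._+_ (f≡0 zero) (sumFin-zero (f ∘ suc) (f≡0 ∘ suc))

sumFin-single : (f : Fin m → ℤ) (k : Fin m) → (∀ k′ → k′ ≢ k → f k′ ≡ + 0) → sumFin f ≡ f k
sumFin-single {suc m} f zero f≡0 =
  trans (cong (λ x → f zero ℤ.+ x) (sumFin-zero (f ∘ suc) (λ k′ → f≡0 (suc k′) λ ())))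
        (ℤₚ.+-identityʳ (f zero))
sumFin-single {suc m} f (suc k) f≡0 =
  trans (cong₂ ℤ._+_ (f≡0 zero λ ())
                     (sumFin-single (f ∘ suc) k (λ k′ k′≢k → f≡0 (suc k′) (k′≢k ∘ Finₚ.suc-injective))))
        (ℤₚ.+-identityˡ _)

module _ {M : Matrix d} (S : SignedPermForm M) where
  open SignedPermForm S

  ⊙-signedPerm : ∀ p r → (M ⊙ p) r ≡ signed (sign r) (p (col r))
  ⊙-signedPerm p r = begin
    sumFin (λ c → M r c ℤ.* p c)  ≡⟨ sumFin-single _ (col r) (λ c c≢col → cong (ℤ._* p c)
                                       (off-support r c (c≢col ∘ sym)) ) ⟩
    M r (col r) ℤ.* p (col r)     ≡⟨ cong (ℤ._* p (col r)) (on-support r) ⟩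
    (sign r ◃ 1) ℤ.* p (col r)    ≡⟨ ◃1-* (sign r) (p (col r)) ⟩
    signed (sign r) (p (col r))   ∎
    where open ≡-Reasoning

  ⊙-distinct : {F : Family m d} → DistinctCoordinates F → DistinctCoordinates (λ a → M ⊙ F a)
  ⊙-distinct {F = F} F-distinct c {a} {b} eq = F-distinct (col c) (signed-injective (sign c)
    (trans (sym (⊙-signedPerm (F a) c)) (trans eq (⊙-signedPerm (F b) c))))

  sameOrder-⊙ : {F G : Family m d} → SameOrder F G → SameOrder (λ a → M ⊙ F a) (λ a → M ⊙ G a)
  sameOrder-⊙ {F = F} {G} F∼G = begin
    (λ a → M ⊙ F a)                          ≈⟨ ≗⇒sameOrder (λ a → ⊙-signedPerm (F a)) ⟩
    (λ a c → signed (sign c) (F a (col c)))  ≈⟨ (λ a b c → signed-<-⇔ (sign c) (F∼G a b (col c))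
                                                                               (F∼G b a (col c))) ⟩
    (λ a c → signed (sign c) (G a (col c)))  ≈⟨ ≗⇒sameOrder (λ a → ⊙-signedPerm (G a)) ⟨
    (λ a → M ⊙ G a)                          ∎
    where open SetoidReasoning (sameOrder-setoid _ _)

idM-diagonal : (r : Fin d) → idM r r ≡ + 1
idM-diagonal r with r Fin.≟ r
... | yes _  = refl
... | no r≢r = contradiction refl r≢r

idM-offDiagonal : {r c : Fin d} → r ≢ c → idM r c ≡ + 0
idM-offDiagonal {r = r} {c} r≢c with r Fin.≟ c
... | yes r≡c = contradiction r≡c r≢c
... | no _    = refl

-- In column col c of N ⊗ M only the term N r c * M c (col c) survives.
leftInverse-form : {M N : Matrix d} → SignedPermForm M → (∀ r c → (N ⊗ M) r c ≡ idM r c) → SignedPermForm N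
leftInverse-form {M = M} {N} S N⊗M≡I = record
  { col = row ; row = col ; sign = sign ∘ row ; col∘row = row∘col ; row∘col = col∘row
  ; off-support = off-support′ ; on-support = on-support′ }
  where
  open SignedPermForm S
  column : ∀ r c → signed (sign c) (N r c) ≡ idM r (col c)
  column r c = begin
    signed (sign c) (N r c)               ≡⟨ ◃1-* (sign c) (N r c) ⟨
    (sign c ◃ 1) ℤ.* N r c                ≡⟨ ℤₚ.*-comm (sign c ◃ 1) (N r c) ⟩
    N r c ℤ.* (sign c ◃ 1)                ≡⟨ cong (N r c ℤ.*_) (on-support c) ⟨
    N r c ℤ.* M c (col c)                 ≡⟨ sumFin-single (λ k → N r k ℤ.* M k (col c)) c (λ k k≢c →
                                               trans (cong (N r k ℤ.*_) (off-support k (col c) (k≢c ∘ col-injective)))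
                                                     (ℤₚ.*-zeroʳ (N r k))) ⟨
    (N ⊗ M) r (col c)                     ≡⟨ N⊗M≡I r (col c) ⟩
    idM r (col c)                         ∎
    where
    open ≡-Reasoning
    col-injective : ∀ {k} → col k ≡ col c → k ≡ c
    col-injective {k} eq = trans (sym (row∘col k)) (trans (cong row eq) (row∘col c))
  off-support′ : ∀ r c → row r ≢ c → N r c ≡ + 0
  off-support′ r c row≢c = signed-injective (sign c) (trans (column r c)
    (trans (idM-offDiagonal (λ r≡col → row≢c (trans (cong row r≡col) (row∘col c)))) (sym (signed-0 (sign c)))))
  on-support′ : ∀ r → N r (row r) ≡ sign (row r) ◃ 1
  on-support′ r = begin
    N r (row r)                                      ≡⟨ signed-involutive (sign (row r)) _ ⟨
    signed (sign (row r)) (signed (sign (row r)) (N r (row r)))  ≡⟨ cong (signed (sign (row r))) (column r (row r)) ⟩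
    signed (sign (row r)) (idM r (col (row r)))     ≡⟨ cong (signed (sign (row r)) ∘ idM r) (col∘row r) ⟩
    signed (sign (row r)) (idM r r)                 ≡⟨ cong (signed (sign (row r))) (idM-diagonal r) ⟩
    signed (sign (row r)) (+ 1)                     ≡⟨ signed-1 (sign (row r)) ⟩
    sign (row r) ◃ 1                                ∎
    where open ≡-Reasoning

module _ {M N : Matrix d} (S : SignedPermForm M) (N⊗M≡I : ∀ r c → (N ⊗ M) r c ≡ idM r c) where
  open SignedPermForm S

  private
    S⁻¹ : SignedPermForm N
    S⁻¹ = leftInverse-form S N⊗M≡I

  ⊙-inverseˡ : ∀ p r → (N ⊙ (M ⊙ p)) r ≡ p r
  ⊙-inverseˡ p r = begin
    (N ⊙ (M ⊙ p)) r                          ≡⟨ ⊙-signedPerm S⁻¹ (M ⊙ p) r ⟩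
    signed (sign (row r)) ((M ⊙ p) (row r))  ≡⟨ cong (signed (sign (row r))) (⊙-signedPerm S p (row r)) ⟩
    signed (sign (row r)) (signed (sign (row r)) (p (col (row r))))
                                             ≡⟨ signed-involutive (sign (row r)) _ ⟩
    p (col (row r))                          ≡⟨ cong p (col∘row r) ⟩
    p r                                      ∎
    where open ≡-Reasoning

  ⊙-inverseʳ : ∀ p r → (M ⊙ (N ⊙ p)) r ≡ p r
  ⊙-inverseʳ p r = begin
    (M ⊙ (N ⊙ p)) r                          ≡⟨ ⊙-signedPerm S (N ⊙ p) r ⟩
    signed (sign r) ((N ⊙ p) (col r))        ≡⟨ cong (signed (sign r)) (⊙-signedPerm S⁻¹ p (col r)) ⟩
    signed (sign r) (signed (sign (row (col r))) (p (row (col r))))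
                                             ≡⟨ cong (λ x → signed (sign r) (signed (sign x) (p x))) (row∘col r) ⟩
    signed (sign r) (signed (sign r) (p r))  ≡⟨ signed-involutive (sign r) (p r) ⟩
    p r                                      ∎
    where open ≡-Reasoning

module _ {M : Matrix (suc e)} (S : SignedPermForm M) where
  open SignedPermForm S

  ⊙-cong : {p q : Point (suc e)} → (∀ c → p c ≡ q c) → ∀ r → (M ⊙ p) r ≡ (M ⊙ q) r
  ⊙-cong {p} {q} p≗q r =
    trans (⊙-signedPerm S p r) (trans (cong (signed (sign r)) (p≗q (col r))) (sym (⊙-signedPerm S q r)))

  image-isPermFamily : {σ : DPerm e n} → IsDPerm σ → IsPermFamily (std (λ a → M ⊙ diag σ a))
  image-isPermFamily σ-perm = std-isPermFamily (⊙-distinct S (isPermFamily⇒distinct (diag-isPermFamily σ-perm)))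

  act-isDPerm : {σ : DPerm e n} → IsDPerm σ → IsDPerm (act M σ)
  act-isDPerm σ-perm = fromDiagram-isDPerm (image-isPermFamily σ-perm)

  act-cong : {σ σ′ : DPerm e n} → IsDPerm σ → IsDPerm σ′ → σ ≗D σ′ → act M σ ≗D act M σ′
  act-cong σ-perm σ′-perm σ≗σ′ = fromDiagram-cong (image-isPermFamily σ-perm) (image-isPermFamily σ′-perm)
    (sameOrder⇒std-≡ (≗⇒sameOrder (λ a → ⊙-cong (diag-cong σ≗σ′ a))))

module _ {M N : Matrix (suc e)} (S : SignedPermForm M) (T : SignedPermForm N)
         (N⊙M⊙p≡p : ∀ p r → (N ⊙ (M ⊙ p)) r ≡ p r) where

  act-inverse : {σ : DPerm e n} → IsDPerm σ → act N (act M σ) ≗D σ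
  act-inverse {n = n} {σ} σ-perm = fromDiagram-≗D Z-perm (sameOrder⇒≗ Z-perm
    (restrict-isPermFamily (diag-isPermFamily σ-perm) (preimage-injective (first-injective Y-perm)) id) (begin
      std (λ a → N ⊙ diag (act M σ) a)
        ≈⟨ std-sameOrder _ ⟩
      (λ a → N ⊙ diag (act M σ) a)
        ≈⟨ ≗⇒sameOrder (λ a → ⊙-cong T (diag-fromDiagram-pointAt Y-perm a)) ⟩
      (λ a → N ⊙ Y (φ a))
        ≈⟨ sameOrder-⊙ T (sameOrder-restrict (std-sameOrder (λ a → M ⊙ diag σ a)) φ id) ⟩
      (λ a → N ⊙ (M ⊙ diag σ (φ a)))
        ≈⟨ ≗⇒sameOrder (λ a → N⊙M⊙p≡p (diag σ (φ a))) ⟩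
      restrict (diag σ) φ id
        ∎))
    where
    open SetoidReasoning (sameOrder-setoid _ _)
    Y : Family n (suc e)
    Y = std (λ a → M ⊙ diag σ a)
    Y-perm : IsPermFamily Y
    Y-perm = image-isPermFamily S σ-perm
    φ : Fin n → Fin n
    φ = pointAt Y-perm
    Z-perm : IsPermFamily (std (λ a → N ⊙ diag (act M σ) a))
    Z-perm = image-isPermFamily T (act-isDPerm S σ-perm)

  act-injective : {σ₁ σ₂ : DPerm e n} → IsDPerm σ₁ → IsDPerm σ₂ →
                  act M σ₁ ≗D act M σ₂ → σ₁ ≗D σ₂
  act-injective {σ₁ = σ₁} {σ₂} σ₁-perm σ₂-perm eq r j = begin
    σ₁ r j                    ≡⟨ act-inverse σ₁-perm r j ⟨
    act N (act M σ₁) r j      ≡⟨ act-cong T (act-isDPerm S σ₁-perm) (act-isDPerm S σ₂-perm) eq r j ⟩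
    act N (act M σ₂) r j      ≡⟨ act-inverse σ₂-perm r j ⟩
    σ₂ r j                    ∎
    where open ≡-Reasoning

-- Submatrices

module _ {A : Set} {_≺_ : A → A → Set}
         (≺-irrefl : ∀ {x} → ¬ x ≺ x) (≺-asym : ∀ {x y} → x ≺ y → ¬ y ≺ x) where

  sorted-≡ : {xs ys : List A} → AllPairs _≺_ xs → AllPairs _≺_ ys →
             (∀ {z} → z ∈ xs → z ∈ ys) → (∀ {z} → z ∈ ys → z ∈ xs) → xs ≡ ys
  sorted-≡ [] [] _ _ = refl
  sorted-≡ [] (_ ∷ _) _ ys⊆xs with ys⊆xs (here refl)
  ... | ()
  sorted-≡ (_ ∷ _) [] xs⊆ys _ with xs⊆ys (here refl)
  ... | ()
  sorted-≡ {x ∷ xs} {y ∷ ys} (x≺xs ∷ xs↑) (y≺ys ∷ ys↑) xs⊆ys ys⊆xs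
    with heads-≡ (xs⊆ys (here refl)) (ys⊆xs (here refl))
    where
    heads-≡ : x ∈ y ∷ ys → y ∈ x ∷ xs → x ≡ y
    heads-≡ (here x≡y) _          = x≡y
    heads-≡ (there _)  (here y≡x) = sym y≡x
    heads-≡ (there x∈ys) (there y∈xs) = contradiction (All.lookup x≺xs y∈xs) (≺-asym (All.lookup y≺ys x∈ys))
  ... | refl = cong (x ∷_) (sorted-≡ xs↑ ys↑ (tail x≺xs xs⊆ys) (tail y≺ys ys⊆xs))
    where
    tail : ∀ {zs zs′} → All.All (x ≺_) zs → (∀ {z} → z ∈ x ∷ zs → z ∈ x ∷ zs′) →
           ∀ {z} → z ∈ zs → z ∈ zs′
    tail x≺zs zs⊆zs′ z∈zs with zs⊆zs′ (there z∈zs)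
    ... | here refl = contradiction (All.lookup x≺zs z∈zs) ≺-irrefl
    ... | there z∈zs′ = z∈zs′

nth-tabulate : {A : Set} (f : Fin n → A) (b : Fin n) → nth (tabulate f) (toℕ b) ≡ just (f b)
nth-tabulate f zero    = refl
nth-tabulate f (suc b) = nth-tabulate (f ∘ suc) b

record RowsOver {M : Matrix d} (S : SignedPermForm M) (i : Fin d′ → Fin d) : Set where
  field
    rows            : Fin d′ → Fin d
    rows-increasing : Increasing rows
    subMatrix-form  : SignedPermForm (subMatrix M rows)
    ⊙-subMatrix     : ∀ p a → (M ⊙ p) (rows a) ≡ (subMatrix M rows ⊙ (p ∘ i)) a

-- J lists the rows row ∘ i in increasing order; the sorting permutation is
-- the rank function of row ∘ i.
module Rows {M : Matrix d} (S : SignedPermForm M) {i : Fin d′ → Fin d} (i↑ : Increasing i) where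
  open SignedPermForm S

  private
    rowsOfI : Family d′ 1
    rowsOfI b _ = + toℕ (row (i b))

    rowsOfI-distinct : DistinctCoordinates rowsOfI
    rowsOfI-distinct zero eq = increasing⇒injective i↑
      (trans (sym (col∘row _)) (trans (cong col (Finₚ.toℕ-injective (ℤₚ.+-injective eq))) (col∘row _)))

    rank-perm : ∃[ ρ ] (Injective _≡_ _≡_ ρ × ∀ a → std rowsOfI a zero ≡ + toℕ (ρ a))
    rank-perm = std-isPermFamily rowsOfI-distinct zero

  rank : Fin d′ → Fin d′
  rank = proj₁ rank-perm

  rank-injective : Injective _≡_ _≡_ rank
  rank-injective = proj₁ (proj₂ rank-perm)

  β : Fin d′ → Fin d′
  β = preimage rank-injective

  J : Fin d′ → Fin d
  J = row ∘ i ∘ β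

  col∘J : ∀ a → col (J a) ≡ i (β a)
  col∘J a = col∘row (i (β a))

  J-increasing : Increasing J
  J-increasing a b a<b = ℤₚ.drop‿+<+ (std-cancel-< rowsOfI {c = zero}
    (subst₂ ℤ._<_ (sym (std-rank a)) (sym (std-rank b)) (+<+ a<b)))
    where
    std-rank : ∀ x → std rowsOfI (β x) zero ≡ + toℕ x
    std-rank x = trans (proj₂ (proj₂ rank-perm) (β x)) (cong (+_ ∘ toℕ) (apply-preimage rank-injective x))

  subMatrix-entry : ∀ a b → subMatrix M J a b ≡ M (J a) (i b)
  subMatrix-entry a b =
    cong (maybe (M (J a)) (+ 0)) (trans (cong (λ cs → nth cs (toℕ b)) columns≡i) (nth-tabulate i b))
    where
    hits : Fin d → Set
    hits c = ∃[ a′ ] (M (J a′) c ≢ + 0)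
    hits? : Decidable hits
    hits? c = Finₚ.any? (λ a′ → ¬? (M (J a′) c ℤ.≟ + 0))
    columns≡i : filter hits? (allFin d) ≡ tabulate i
    columns≡i = sorted-≡ (Finₚ.<-irrefl refl) Finₚ.<-asym
      (AllPairsₚ.filter⁺ hits? (AllPairsₚ.tabulate⁺-< id)) (AllPairsₚ.tabulate⁺-< (i↑ _ _)) ⊆i i⊆
      where
      ⊆i : ∀ {c} → c ∈ filter hits? (allFin d) → c ∈ tabulate i
      ⊆i {c} c∈ with proj₂ (∈-filter⁻ hits? {xs = allFin d} c∈)
      ... | a′ , M≢0 with col (J a′) Fin.≟ c
      ... | yes refl = subst (_∈ tabulate i) (sym (col∘J a′)) (∈-tabulate⁺ (β a′))
      ... | no col≢c = contradiction (off-support (J a′) c col≢c) M≢0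
      i⊆ : ∀ {c} → c ∈ tabulate i → c ∈ filter hits? (allFin d)
      i⊆ c∈ with ∈-tabulate⁻ c∈
      ... | b , refl = ∈-filter⁺ hits? (∈-allFin (i b)) (rank b , λ M≡0 → ◃1≢0 (sign (J (rank b)))
        (trans (sym (on-support (J (rank b)))) (trans (cong (M (J (rank b))) col∘J∘rank) M≡0)))
        where
        col∘J∘rank : col (J (rank b)) ≡ i b
        col∘J∘rank = trans (col∘J (rank b)) (cong i (preimage-apply rank-injective b))

  subMatrix-form : SignedPermForm (subMatrix M J)
  subMatrix-form = record
    { col = β ; row = rank ; sign = sign ∘ J
    ; col∘row = preimage-apply rank-injective ; row∘col = apply-preimage rank-injective
    ; off-support = λ a b β≢b → trans (subMatrix-entry a b) (off-support (J a) (i b)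
        (λ col≡i → β≢b (increasing⇒injective i↑ (trans (sym (col∘J a)) col≡i))))
    ; on-support = λ a → trans (subMatrix-entry a (β a)) (trans (cong (M (J a)) (sym (col∘J a))) (on-support (J a)))
    }

  ⊙-subMatrix : ∀ p a → (M ⊙ p) (J a) ≡ (subMatrix M J ⊙ (p ∘ i)) a
  ⊙-subMatrix p a = begin
    (M ⊙ p) (J a)                        ≡⟨ ⊙-signedPerm S p (J a) ⟩
    signed (sign (J a)) (p (col (J a)))  ≡⟨ cong (signed (sign (J a)) ∘ p) (col∘J a) ⟩
    signed (sign (J a)) (p (i (β a)))    ≡⟨ ⊙-signedPerm subMatrix-form (p ∘ i) a ⟨
    (subMatrix M J ⊙ (p ∘ i)) a          ∎
    where open ≡-Reasoning

rowsOver : {M : Matrix d} (S : SignedPermForm M) {i : Fin d′ → Fin d} → Increasing i → RowsOver S i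
rowsOver S i↑ = record
  { rows = J ; rows-increasing = J-increasing ; subMatrix-form = subMatrix-form ; ⊙-subMatrix = ⊙-subMatrix }
  where open Rows S i↑

-- Occurrences of patterns

sameSet-congˡ : {X X′ : Family m d} {Y : Family m′ d} → (∀ a c → X a c ≡ X′ a c) →
                SameSet X Y → SameSet X′ Y
sameSet-congˡ X≗X′ (X⊆Y , Y⊆X) =
  (λ a → proj₁ (X⊆Y a) , λ c → trans (sym (X≗X′ a c)) (proj₂ (X⊆Y a) c)) ,
  (λ b → proj₁ (Y⊆X b) , λ c → trans (proj₂ (Y⊆X b) c) (X≗X′ _ c))

sameSet-congʳ : {X : Family m d} {Y Y′ : Family m′ d} → (∀ a c → Y a c ≡ Y′ a c) →
                SameSet X Y → SameSet X Y′
sameSet-congʳ Y≗Y′ (X⊆Y , Y⊆X) =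
  (λ a → proj₁ (X⊆Y a) , λ c → trans (proj₂ (X⊆Y a) c) (Y≗Y′ _ c)) ,
  (λ b → proj₁ (Y⊆X b) , λ c → trans (sym (Y≗Y′ b c)) (proj₂ (Y⊆X b) c))

sameSet⇒reindexing : {X Y : Family k (suc d)} → DistinctCoordinates X → SameSet X Y →
                     ∃[ h ] (Injective _≡_ _≡_ h × ∀ a c → X a c ≡ Y (h a) c)
sameSet⇒reindexing {k = k} {X = X} {Y} X-distinct (X⊆Y , _) = h , h-injective , X≡Yh
  where
  h : Fin k → Fin k
  h = proj₁ ∘ X⊆Y
  X≡Yh : ∀ a c → X a c ≡ Y (h a) c
  X≡Yh = proj₂ ∘ X⊆Y
  h-injective : Injective _≡_ _≡_ h
  h-injective {a} {b} eq =
    X-distinct zero (trans (X≡Yh a zero) (trans (cong (λ x → Y x zero) eq) (sym (X≡Yh b zero))))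

reindexing⇒sameSet : {X Y : Family k d} {h : Fin k → Fin k} → Injective _≡_ _≡_ h →
                     (∀ a c → X a c ≡ Y (h a) c) → SameSet X Y
reindexing⇒sameSet {Y = Y} h-inj X≡Yh =
  (λ a → _ , X≡Yh a) ,
  (λ b → let (a , ha≡b) = injective⇒surjective h-inj b in
         a , λ c → trans (cong (λ x → Y x c) (sym (ha≡b refl))) (sym (X≡Yh a c)))

-- Contains, read off the diagram of σ itself rather than that of proj i σ.
Occurs : DPerm e n → Pattern → Set
Occurs {e} {n} σ (pat e′ k π) =
  ∃[ i ] (Increasing {suc e′} {suc e} i × Σ (Fin k → Fin n) λ g →
    (Injective _≡_ _≡_ g × SameSet (std (restrict (diag σ) g i)) (diag π)))

module _ {σ : DPerm e n} (σ-perm : IsDPerm σ) where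

  private
    projection-isPermFamily : (i : Fin (suc e′) → Fin (suc e)) → IsPermFamily (restrict (diag σ) id i)
    projection-isPermFamily = restrict-isPermFamily (diag-isPermFamily σ-perm) id

  contains⇒occurs : {π : Pattern} → Contains σ π → Occurs σ π
  contains⇒occurs {pat _ _ _} (i , i↑ , sel , sel-inj , std≈π) =
    i , i↑ , pointAt Q-perm ∘ sel , sel-inj ∘ preimage-injective (first-injective Q-perm) ,
    sameSet-congˡ (sameOrder⇒std-≡ (≗⇒sameOrder (λ a → diag-fromDiagram-pointAt Q-perm (sel a)))) std≈π
    where
    Q-perm : IsPermFamily (restrict (diag σ) id i)
    Q-perm = projection-isPermFamily i

  occurs⇒contains : {π : Pattern} → Occurs σ π → Contains σ π
  occurs⇒contains {pat _ _ _} (i , i↑ , g , g-inj , std≈π) =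
    i , i↑ , first Q-perm ∘ g , g-inj ∘ first-injective Q-perm ,
    sameSet-congˡ (sameOrder⇒std-≡ (≗⇒sameOrder (λ a c → sym (diag-fromDiagram Q-perm (g a) c)))) std≈π
    where
    Q-perm : IsPermFamily (restrict (diag σ) id i)
    Q-perm = projection-isPermFamily i

occurs-cong : {σ σ′ : DPerm e n} {π : Pattern} → σ ≗D σ′ → Occurs σ π → Occurs σ′ π
occurs-cong {π = pat _ _ _} σ≗σ′ (i , i↑ , g , g-inj , std≈π) =
  i , i↑ , g , g-inj ,
  sameSet-congˡ (sameOrder⇒std-≡ (≗⇒sameOrder (λ a c → diag-cong σ≗σ′ (g a) (i c)))) std≈π

contains-congʳ : {σ : DPerm e n} {π π′ : Pattern} → π ≈P π′ → Contains σ π → Contains σ π′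
contains-congʳ (eqP f≗f′) (i , i↑ , sel , sel-inj , std≈f) =
  i , i↑ , sel , sel-inj , sameSet-congʳ (diag-cong f≗f′) std≈f

module _ {M : Matrix (suc e)} (S : SignedPermForm M) {i : Fin (suc e′) → Fin (suc e)} (R : RowsOver S i) where
  open RowsOver R

  act-restrict-sameOrder : {ρ : DPerm e n} (ρ-perm : IsDPerm ρ) (g : Fin k → Fin n) →
    SameOrder (restrict (diag (act M ρ)) (first (image-isPermFamily S ρ-perm) ∘ g) rows)
              (λ a → subMatrix M rows ⊙ (diag ρ (g a) ∘ i))
  act-restrict-sameOrder {ρ = ρ} ρ-perm g = begin
    restrict (diag (act M ρ)) (first Y-perm ∘ g) rows
      ≈⟨ ≗⇒sameOrder (λ a c → diag-fromDiagram Y-perm (g a) (rows c)) ⟩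
    restrict (std (λ t → M ⊙ diag ρ t)) g rows
      ≈⟨ sameOrder-restrict (std-sameOrder (λ t → M ⊙ diag ρ t)) g rows ⟩
    restrict (λ t → M ⊙ diag ρ t) g rows
      ≈⟨ ≗⇒sameOrder (λ a → ⊙-subMatrix (diag ρ (g a))) ⟩
    (λ a → subMatrix M rows ⊙ (diag ρ (g a) ∘ i))
      ∎
    where
    open SetoidReasoning (sameOrder-setoid _ _)
    Y-perm : IsPermFamily (std (λ t → M ⊙ diag ρ t))
    Y-perm = image-isPermFamily S ρ-perm

  occurs-act-rows : {ρ : DPerm e n} → IsDPerm ρ → {f : DPerm e′ k} → IsDPerm f →
                    (g : Fin k → Fin n) → Injective _≡_ _≡_ g → SameSet (std (restrict (diag ρ) g i)) (diag f) →
                    Occurs (act M ρ) (pat e′ k (act (subMatrix M rows) f))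
  occurs-act-rows {ρ = ρ} ρ-perm {f} f-perm g g-inj A≈f with sameSet⇒reindexing
    (std-distinct (restrict-distinct (isPermFamily⇒distinct (diag-isPermFamily ρ-perm)) g-inj i)) A≈f
  ... | h , h-inj , std-A≡fh =
    rows , rows-increasing , first Y-perm ∘ g , g-inj ∘ first-injective Y-perm ,
    reindexing⇒sameSet (h-inj ∘ first-injective W-perm) std-B≡
    where
    Y-perm : IsPermFamily (std (λ t → M ⊙ diag ρ t))
    Y-perm = image-isPermFamily S ρ-perm
    W-perm : IsPermFamily (std (λ b → subMatrix M rows ⊙ diag f b))
    W-perm = image-isPermFamily subMatrix-form f-perm
    A∼fh : SameOrder (λ a → diag ρ (g a) ∘ i) (λ a → diag f (h a))
    A∼fh = SameOrder.trans (SameOrder.sym (std-sameOrder (restrict (diag ρ) g i))) (≗⇒sameOrder std-A≡fh)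
    std-B≡ : ∀ a c → std (restrict (diag (act M ρ)) (first Y-perm ∘ g) rows) a c ≡
                     diag (act (subMatrix M rows) f) (first W-perm (h a)) c
    std-B≡ a c = begin
      std (restrict (diag (act M ρ)) (first Y-perm ∘ g) rows) a c
        ≡⟨ sameOrder⇒std-≡ (SameOrder.trans (act-restrict-sameOrder ρ-perm g)
                                            (sameOrder-⊙ subMatrix-form A∼fh)) a c ⟩
      std (λ b → subMatrix M rows ⊙ diag f (h b)) a c
        ≡⟨ std-reindex (⊙-distinct subMatrix-form (isPermFamily⇒distinct (diag-isPermFamily f-perm))) h-inj a c ⟩
      std (λ b → subMatrix M rows ⊙ diag f b) (h a) c
        ≡⟨ diag-fromDiagram W-perm (h a) c ⟨
      diag (act (subMatrix M rows) f) (first W-perm (h a)) c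
        ∎
      where open ≡-Reasoning

occurs-act : {M : Matrix (suc e)} → SignedPermForm M → {ρ : DPerm e n} → IsDPerm ρ →
             {f : DPerm e′ k} → IsDPerm f → Occurs ρ (pat e′ k f) →
             ∃[ J′ ] (Increasing J′ × Occurs (act M ρ) (pat e′ k (act (subMatrix M J′) f)))
occurs-act S ρ-perm f-perm (i , i↑ , g , g-inj , A≈f) =
  rows , rows-increasing , occurs-act-rows S R ρ-perm f-perm g g-inj A≈f
  where
  R : RowsOver S i
  R = rowsOver S i↑
  open RowsOver R

act-avoids : {M N : Matrix (suc e)} → SignedPermForm M → SignedPermForm N →
             (∀ p r → (N ⊙ (M ⊙ p)) r ≡ p r) →
             {Π T : List Pattern} → (∀ τ → τ ∈ T → IsDPerm (perm τ)) →
             (∀ τ → InTilde N T τ → InList Π τ) →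
             {σ : DPerm e n} → IsDPerm σ → Avoids σ Π → Avoids (act M σ) T
act-avoids {N = N} S T N⊙M⊙p≡p T-perm Ñ[T]⊆Π σ-perm σ-avoids (pat e′ k f) τ∈T Mσ-contains =
  let Mσ-perm = act-isDPerm S σ-perm
      J′ , J′↑ , NMσ-occurs = occurs-act T Mσ-perm (T-perm _ τ∈T) (contains⇒occurs Mσ-perm Mσ-contains)
      π , π∈Π , ≈π = Ñ[T]⊆Π (pat e′ k (act (subMatrix N J′) f))
                            (pat e′ k f , τ∈T , J′ , J′↑ , eqP (λ _ _ → refl))
      σ-occurs = occurs-cong (act-inverse S T N⊙M⊙p≡p σ-perm) NMσ-occurs
  in σ-avoids π π∈Π (contains-congʳ ≈π (occurs⇒contains σ-perm σ-occurs))

proposition3 : (e : ℕ) → 1 ≤ e →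
    (Π T : List Pattern) →
    (∀ π → π ∈ Π → IsDPerm (perm π) × suc (dim′ π) ≤ suc e) →
    (∀ τ → τ ∈ T → IsDPerm (perm τ) × suc (dim′ τ) ≤ suc e) →
    (s s⁻¹ : Matrix (suc e)) → IsSignedPerm s →
    (∀ r c → (s⁻¹ ⊗ s) r c ≡ idM r c) →
    SameSetP (InTilde s Π) (InList T) →
    SameSetP (InList Π) (InTilde s⁻¹ T) →
    TriviallyWilfEquiv e Π T
proposition3 e _ Π T Π-valid T-valid s s⁻¹ s-signedPerm s⁻¹⊗s≡I s̃[Π]≡T Π≡s̃⁻¹[T] =
  s , s-signedPerm , λ n → maps-into , injective , surjective
  where
  S : SignedPermForm s
  S = isSignedPerm⇒form s-signedPerm
  S⁻¹ : SignedPermForm s⁻¹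
  S⁻¹ = leftInverse-form S s⁻¹⊗s≡I
  s⁻¹⊙s⊙p≡p : ∀ p r → (s⁻¹ ⊙ (s ⊙ p)) r ≡ p r
  s⁻¹⊙s⊙p≡p = ⊙-inverseˡ {N = s⁻¹} S s⁻¹⊗s≡I
  s⊙s⁻¹⊙p≡p : ∀ p r → (s ⊙ (s⁻¹ ⊙ p)) r ≡ p r
  s⊙s⁻¹⊙p≡p = ⊙-inverseʳ {N = s⁻¹} S s⁻¹⊗s≡I
  maps-into : ∀ σ → InS n Π σ → InS n T (act s σ)
  maps-into σ (σ-perm , σ-avoids) = act-isDPerm S σ-perm ,
    act-avoids S S⁻¹ s⁻¹⊙s⊙p≡p (λ τ → proj₁ ∘ T-valid τ) (λ τ → proj₂ (Π≡s̃⁻¹[T] τ))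
      σ-perm σ-avoids
  injective : ∀ σ₁ σ₂ → InS n Π σ₁ → InS n Π σ₂ → act s σ₁ ≗D act s σ₂ → σ₁ ≗D σ₂
  injective σ₁ σ₂ (σ₁-perm , _) (σ₂-perm , _) = act-injective S S⁻¹ s⁻¹⊙s⊙p≡p σ₁-perm σ₂-perm
  surjective : ∀ τ → InS n T τ → ∃[ σ ] (InS n Π σ × act s σ ≗D τ)
  surjective τ (τ-perm , τ-avoids) = act s⁻¹ τ ,
    (act-isDPerm S⁻¹ τ-perm ,
     act-avoids S⁻¹ S s⊙s⁻¹⊙p≡p (λ π → proj₁ ∘ Π-valid π) (λ π → proj₁ (s̃[Π]≡T π))
       τ-perm τ-avoids) ,
    act-inverse S⁻¹ S s⊙s⁻¹⊙p≡p τ-perm
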